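{- Let $R$ be an unramified dyadic local ring and let $\ell$ be an even $R$-lattice of rank $n\ge1$. If $J$ is an $R$-lattice with $Q^\ast(\ell)\cap Q^\ast(J)\ne\varnothing$, then $\ell$ is primitively represented by $\mathbb{H}^{n-1}\perp J$.
   Context: $R$ is the ring of integers of a nonarchimedean local field of characteristic $0$ in which $2$ is a prime element of $R$. An $R$-lattice is a finitely generated $R$-submodule of a quadratic space with symmetric bilinear form $B$, $Q(v)=B(v,v)$, assumed integral ($B(L,L)\subseteq R$) and nondegenerate; even means $Q(L)\subseteq2R$. $Q^\ast(L)$ is the set of $Q(v)$ for primitive vectors $v\in L$ (vectors spanning a direct summand). A representation is an $R$-linear map preserving $B$, primitive if its image is a direct summand. $\mathbb{H}$ has Gram matrix $\begin{pmatrix}0&1\\1&0\end{pmatrix}$ and $\mathbb{H}^{k}$ is the orthogonal sum of $k$ copies ($\mathbb{H}^0=0$). -}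

module Defs where

open import Level using (Level; _⊔_) renaming (suc to lsuc)
open import Algebra.Bundles using (CommutativeRing)
open import Data.Nat as ℕ using (ℕ; zero; suc)
open import Data.Fin using (Fin; splitAt) renaming (zero to fzero; suc to fsuc)
open import Data.Sum using (_⊎_; inj₁; inj₂)
open import Data.Product using (Σ; ∃; _×_; _,_)
open import Data.List using (List)
open import Data.List.Membership.Propositional using (_∈_)
open import Relation.Binary.PropositionalEquality using (_≡_)
open import Relation.Nullary using (¬_)

-- The ring R: ring of integers of a nonarchimedean local field of
-- characteristic 0 in which 2 is a prime element (unramified dyadic).
-- Axiomatised as: a commutative integral domain, every nonzero element
-- is 2^k · (unit) with 2 not a unit (so R is a DVR with uniformizer 2),
-- finite residue field R/2R, 2-adically complete, characteristic 0.

module RingNotation {c ℓ : Level} (ring : CommutativeRing c ℓ) where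
  open CommutativeRing ring

  _∣R_ : Carrier → Carrier → Set (c ⊔ ℓ)
  a ∣R b = ∃ λ d → b ≈ a * d

  Unit : Carrier → Set (c ⊔ ℓ)
  Unit u = ∃ λ v → u * v ≈ 1#

  two : Carrier
  two = 1# + 1#

  _^R_ : Carrier → ℕ → Carrier
  x ^R zero  = 1#
  x ^R suc k = x * (x ^R k)

  _×1 : ℕ → Carrier
  zero ×1  = 0#
  suc n ×1 = 1# + (n ×1)

record UnramifiedDyadicLocalRing (c ℓ : Level) : Set (lsuc (c ⊔ ℓ)) where
  field
    cring : CommutativeRing c ℓ
  open CommutativeRing cring public
  open RingNotation cring public
  field
    nontrivial    : ¬ (1# ≈ 0#)
    integral      : ∀ x y → x * y ≈ 0# → x ≈ 0# ⊎ y ≈ 0#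
    two-nonunit   : ¬ Unit two
    two-uniformizer : ∀ x → x ≈ 0# ⊎ (∃ λ k → ∃ λ u → Unit u × x ≈ (two ^R k) * u)
    finite-residue : ∃ λ (reps : List Carrier) →
                       ∀ x → ∃ λ r → r ∈ reps × two ∣R (x - r)
    complete      : ∀ (a : ℕ → Carrier) →
                       (∀ n → (two ^R n) ∣R (a (suc n) - a n)) →
                       ∃ λ L → ∀ n → (two ^R n) ∣R (L - a n)
    char0         : ∀ n → (n ×1) ≈ 0# → n ≡ 0

-- Lattices (free R-modules R^n with a symmetric bilinear form given by
-- a Gram matrix with entries in R, hence integral), maps as matrices.

module _ {c ℓ : Level} (R : UnramifiedDyadicLocalRing c ℓ) where
  open UnramifiedDyadicLocalRing R

  Vec : ℕ → Set c
  Vec n = Fin n → Carrier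

  -- Mat m n : matrices with m rows, n columns (maps R^n → R^m)
  Mat : ℕ → ℕ → Set c
  Mat m n = Fin m → Fin n → Carrier

  Σ[_] : ∀ n → (Fin n → Carrier) → Carrier
  Σ[ zero ]  f = 0#
  Σ[ suc n ] f = f fzero + Σ[ n ] (λ i → f (fsuc i))

  Bform : ∀ {n} → Mat n n → Vec n → Vec n → Carrier
  Bform {n} G v w = Σ[ n ] (λ i → Σ[ n ] (λ j → v i * (G i j * w j)))

  Qform : ∀ {n} → Mat n n → Vec n → Carrier
  Qform G v = Bform G v v

  δ : ∀ {n} → Fin n → Fin n → Carrier
  δ fzero    fzero    = 1#
  δ fzero    (fsuc j) = 0#
  δ (fsuc i) fzero    = 0#
  δ (fsuc i) (fsuc j) = δ i j

  column : ∀ {m n} → Mat m n → Fin n → Vec m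
  column X j k = X k j

  record Lattice : Set (c ⊔ ℓ) where
    field
      rank       : ℕ
      gram       : Mat rank rank
      symmetric  : ∀ i j → gram i j ≈ gram j i
      nondegenerate : ∀ (v : Vec rank) →
                        (∀ w → Bform gram v w ≈ 0#) → ∀ i → v i ≈ 0#

  Even : Lattice → Set (c ⊔ ℓ)
  Even L = ∀ v → two ∣R Qform (Lattice.gram L) v

  -- The image of the map X : R^n → R^m is a direct summand of R^m,
  -- expressed as: X has a left inverse (X is injective with image a
  -- direct summand).
  ImageDirectSummand : ∀ {m n} → Mat m n → Set (c ⊔ ℓ)
  ImageDirectSummand {m} {n} X =
    ∃ λ (Y : Mat n m) → ∀ i j → Σ[ m ] (λ k → Y i k * X k j) ≈ δ i j

  PrimitiveVec : ∀ {m} → Vec m → Set (c ⊔ ℓ)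
  PrimitiveVec {m} v = ImageDirectSummand {m} {1} (λ k _ → v k)

  _∈Q*_ : Carrier → Lattice → Set (c ⊔ ℓ)
  a ∈Q* L = ∃ λ (v : Vec (Lattice.rank L)) →
              PrimitiveVec v × Qform (Lattice.gram L) v ≈ a

  _⊥G_ : ∀ {m n} → Mat m m → Mat n n → Mat (m ℕ.+ n) (m ℕ.+ n)
  _⊥G_ {m} {n} G H i j with splitAt m i | splitAt m j
  ... | inj₁ a | inj₁ b = G a b
  ... | inj₂ a | inj₂ b = H a b
  ... | inj₁ _ | inj₂ _ = 0#
  ... | inj₂ _ | inj₁ _ = 0#

  hyperbolic : Mat 2 2
  hyperbolic fzero fzero = 0#
  hyperbolic fzero (fsuc _) = 1#
  hyperbolic (fsuc _) fzero = 1#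
  hyperbolic (fsuc _) (fsuc _) = 0#

  hdim : ℕ → ℕ
  hdim zero    = 0
  hdim (suc k) = 2 ℕ.+ hdim k

  Hpow : ∀ k → Mat (hdim k) (hdim k)
  Hpow zero    = λ ()
  Hpow (suc k) = hyperbolic ⊥G Hpow k

  Represents : ∀ {m n} → Mat m m → Mat n n → Mat m n → Set ℓ
  Represents {m} {n} M G X =
    ∀ i j → Bform M (column X i) (column X j) ≈ G i j

  PrimitivelyRepresents : ∀ {m} → Mat m m → Lattice → Set (c ⊔ ℓ)
  PrimitivelyRepresents {m} M L =
    ∃ λ (X : Mat m (Lattice.rank L)) →
      Represents M (Lattice.gram L) X × ImageDirectSummand X

{-# OPTIONS --safe #-}

-- A primitive vector v of ℓ has a unit coordinate because R is local, so it is
-- the first vector e₀ of a basis e₀, …, eₙ₋₁ of ℓ; in that basis the Gram matrix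
-- K has K₀₀ = Q(v) = a = Q(w) for some primitive w ∈ J. Since ℓ is even, the
-- block (Kᵢⱼ)_{i,j ≥ 1} can be written C + Cᵀ. With (xᵢ, yᵢ), 1 ≤ i < n, the
-- hyperbolic pairs of ℍⁿ⁻¹, the map e₀ ↦ w + Σⱼ K₀ⱼ yⱼ, eᵢ ↦ xᵢ + Σⱼ Cᵢⱼ yⱼ is an
-- isometry, and the xᵢ-coordinates together with a functional ψ on J with
-- ψ(w) = 1 give it a left inverse, so the representation is primitive.

module Submission where

open import Defs
open import Level using (Level; _⊔_)
open import Data.Nat as ℕ using (ℕ; zero; suc; _≤_; _∸_)
open import Data.Fin using (Fin; _↑ˡ_; _↑ʳ_) renaming (zero to fzero; suc to fsuc)
open import Data.Fin.Properties using (splitAt-↑ˡ; splitAt-↑ʳ)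
open import Data.Fin.Permutation as Permutation using (Permutation′; _⟨$⟩ʳ_; _⟨$⟩ˡ_; inverseʳ)
open import Data.Vec.Functional using (_∷_; []; _++_)
open import Data.Vec.Functional.Properties using (lookup-++ˡ; lookup-++ʳ)
open import Data.Product using (∃; ∃₂; _×_; _,_; proj₁; proj₂)
open import Data.Sum using (_⊎_; inj₁; inj₂)
open import Data.Empty using (⊥-elim)
open import Function using (_∘_; flip)
open import Relation.Binary.PropositionalEquality as ≡ using (_≡_)
import Algebra.Properties.Semiring.Sum as SemiringSum
import Algebra.Properties.CommutativeSemigroup as CommutativeSemigroupProperties
import Algebra.Solver.Ring.NaturalCoefficients.Default as NaturalCoefficientsSolver

module _ {c ℓ : Level} (R : UnramifiedDyadicLocalRing c ℓ) where
  open UnramifiedDyadicLocalRing R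
  open SemiringSum semiring
    using (sum; sum-cong-≋; sum-cong-≗; sum-replicate-zero; ∑-comm; *-distribˡ-sum; *-distribʳ-sum)
  open CommutativeSemigroupProperties +-commutativeSemigroup using () renaming (interchange to +-interchange)
  open NaturalCoefficientsSolver commutativeSemiring using (solve; _:=_; _:+_; _:*_; con)
  open import Relation.Binary.Reasoning.Setoid setoid

  -- Unification cannot recover n from Σ n f, so sizes are often passed explicitly below.
  Σ : ∀ n → Vec R n → Carrier
  Σ = Σ[_] R

  Σ≡sum : ∀ n (f : Vec R n) → Σ n f ≡ sum f
  Σ≡sum zero    f = ≡.refl
  Σ≡sum (suc n) f = ≡.cong (f fzero +_) (Σ≡sum n (f ∘ fsuc))

  Σ²≡sum² : ∀ {m n} (f : Fin m → Fin n → Carrier) → Σ m (λ i → Σ n (f i)) ≡ sum (λ i → sum (f i))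
  Σ²≡sum² {m} {n} f = ≡.trans (Σ≡sum m _) (sum-cong-≗ (λ i → Σ≡sum n (f i)))

  Σ-cong : ∀ {n} {f g : Vec R n} → (∀ i → f i ≈ g i) → Σ n f ≈ Σ n g
  Σ-cong {n} {f} {g} f≈g rewrite Σ≡sum n f | Σ≡sum n g = sum-cong-≋ f≈g

  Σ-zero : ∀ {n} {f : Vec R n} → (∀ i → f i ≈ 0#) → Σ n f ≈ 0#
  Σ-zero {n} f≈0 = trans (Σ-cong f≈0) (trans (reflexive (Σ≡sum n _)) (sum-replicate-zero n))

  *-distribˡ-Σ : ∀ {n} x (f : Vec R n) → x * Σ n f ≈ Σ n (λ i → x * f i)
  *-distribˡ-Σ {n} x f rewrite Σ≡sum n f | Σ≡sum n (λ i → x * f i) = *-distribˡ-sum x f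

  *-distribʳ-Σ : ∀ {n} x (f : Vec R n) → Σ n f * x ≈ Σ n (λ i → f i * x)
  *-distribʳ-Σ {n} x f rewrite Σ≡sum n f | Σ≡sum n (λ i → f i * x) = *-distribʳ-sum x f

  Σ-comm : ∀ {m n} (f : Fin m → Fin n → Carrier) →
           Σ m (λ i → Σ n (f i)) ≈ Σ n (λ j → Σ m (λ i → f i j))
  Σ-comm f rewrite Σ²≡sum² f | Σ²≡sum² (flip f) = ∑-comm f

  Σ-splitAt : ∀ m {n} (f : Vec R (m ℕ.+ n)) → Σ (m ℕ.+ n) f ≈ Σ m (f ∘ (_↑ˡ n)) + Σ n (f ∘ (m ↑ʳ_))
  Σ-splitAt zero    f = sym (+-identityˡ _)
  Σ-splitAt (suc m) f = trans (+-congˡ (Σ-splitAt m (f ∘ fsuc))) (sym (+-assoc _ _ _))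

  infix 7 _∙_
  _∙_ : ∀ {n} → Vec R n → Vec R n → Carrier
  _∙_ {n} x y = Σ n (λ i → x i * y i)

  0⃗ : ∀ {n} → Vec R n
  0⃗ _ = 0#

  ∙-comm : ∀ {n} (x y : Vec R n) → x ∙ y ≈ y ∙ x
  ∙-comm x y = Σ-cong (λ i → *-comm (x i) (y i))

  ∙-zeroˡ : ∀ {n} (x : Vec R n) → 0⃗ ∙ x ≈ 0#
  ∙-zeroˡ x = Σ-zero (λ i → zeroˡ (x i))

  ∙-zeroʳ : ∀ {n} (x : Vec R n) → x ∙ 0⃗ ≈ 0#
  ∙-zeroʳ x = Σ-zero (λ i → zeroʳ (x i))

  δ-sym : ∀ {n} (i j : Fin n) → δ R i j ≡ δ R j i
  δ-sym fzero    fzero    = ≡.refl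
  δ-sym fzero    (fsuc j) = ≡.refl
  δ-sym (fsuc i) fzero    = ≡.refl
  δ-sym (fsuc i) (fsuc j) = δ-sym i j

  δ-∙ : ∀ {n} (i : Fin n) (x : Vec R n) → δ R i ∙ x ≈ x i
  δ-∙ fzero    x = trans (+-cong (*-identityˡ _) (∙-zeroˡ (x ∘ fsuc))) (+-identityʳ _)
  δ-∙ (fsuc i) x = trans (+-cong (zeroˡ _) (δ-∙ i (x ∘ fsuc))) (+-identityˡ _)

  ∙-δ : ∀ {n} (x : Vec R n) (i : Fin n) → x ∙ δ R i ≈ x i
  ∙-δ x i = trans (∙-comm x (δ R i)) (δ-∙ i x)

  ∙-++ : ∀ {a b} (x x′ : Vec R a) (y y′ : Vec R b) → (x ++ y) ∙ (x′ ++ y′) ≈ x ∙ x′ + y ∙ y′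
  ∙-++ {a} {b} x x′ y y′ = trans (Σ-splitAt a _) (+-cong
    (Σ-cong {a} (λ i → reflexive (≡.cong₂ _*_ (lookup-++ˡ x y i) (lookup-++ˡ x′ y′ i))))
    (Σ-cong {b} (λ i → reflexive (≡.cong₂ _*_ (lookup-++ʳ x y i) (lookup-++ʳ x′ y′ i)))))

  infixl 7 _·_
  _·_ : ∀ {a b d} → Mat R a b → Mat R b d → Mat R a d
  (X · Y) i j = Σ _ (λ k → X i k * Y k j)

  infixr 7 _*ᵥ_
  _*ᵥ_ : ∀ {a b} → Mat R a b → Vec R b → Vec R a
  (X *ᵥ x) i = Σ _ (λ k → X i k * x k)

  Id : ∀ {n} → Mat R n n
  Id = δ R

  infix 4 _≈ₘ_
  _≈ₘ_ : ∀ {a b} → Mat R a b → Mat R a b → Set ℓ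
  X ≈ₘ Y = ∀ i j → X i j ≈ Y i j

  ·-cong : ∀ {a b d} {X X′ : Mat R a b} {Y Y′ : Mat R b d} → X ≈ₘ X′ → Y ≈ₘ Y′ → X · Y ≈ₘ X′ · Y′
  ·-cong X≈X′ Y≈Y′ i j = Σ-cong (λ k → *-cong (X≈X′ i k) (Y≈Y′ k j))

  ·-assoc : ∀ {a b d e} (X : Mat R a b) (Y : Mat R b d) (Z : Mat R d e) → (X · Y) · Z ≈ₘ X · (Y · Z)
  ·-assoc {b = b} {d} X Y Z i j = begin
    Σ d (λ l → Σ b (λ k → X i k * Y k l) * Z l j)    ≈⟨ Σ-cong {d} (λ l → *-distribʳ-Σ {b} (Z l j) _) ⟩
    Σ d (λ l → Σ b (λ k → X i k * Y k l * Z l j))    ≈⟨ Σ-comm {d} {b} _ ⟩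
    Σ b (λ k → Σ d (λ l → X i k * Y k l * Z l j))    ≈⟨ Σ-cong {b} (λ k → Σ-cong {d} (λ l → *-assoc _ _ _)) ⟩
    Σ b (λ k → Σ d (λ l → X i k * (Y k l * Z l j)))  ≈⟨ Σ-cong {b} (λ k → *-distribˡ-Σ {d} (X i k) _) ⟨
    Σ b (λ k → X i k * Σ d (λ l → Y k l * Z l j))    ∎

  ·-identityˡ : ∀ {a b} (X : Mat R a b) → Id · X ≈ₘ X
  ·-identityˡ X i j = δ-∙ i (column R X j)

  ·-inverse-conj : ∀ {a b d} {X : Mat R a b} {X′ : Mat R b a} {Y : Mat R b d} {Y′ : Mat R d b} →
                   X · X′ ≈ₘ Id → Y · Y′ ≈ₘ Id → (X · Y) · (Y′ · X′) ≈ₘ Id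
  ·-inverse-conj {X = X} {X′} {Y} {Y′} XX′≈I YY′≈I i j = begin
    ((X · Y) · (Y′ · X′)) i j  ≈⟨ ·-assoc X Y (Y′ · X′) i j ⟩
    (X · (Y · (Y′ · X′))) i j  ≈⟨ ·-cong {X = X} (λ _ _ → refl) Y·Y′·X′≈X′ i j ⟩
    (X · X′) i j               ≈⟨ XX′≈I i j ⟩
    δ R i j                    ∎
    where
    Y·Y′·X′≈X′ : Y · (Y′ · X′) ≈ₘ X′
    Y·Y′·X′≈X′ k l = begin
      (Y · (Y′ · X′)) k l  ≈⟨ ·-assoc Y Y′ X′ k l ⟨
      ((Y · Y′) · X′) k l  ≈⟨ ·-cong {Y = X′} YY′≈I (λ _ _ → refl) k l ⟩
      (Id · X′) k l        ≈⟨ ·-identityˡ X′ k l ⟩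
      X′ k l               ∎

  Bform-cong : ∀ {n} {G G′ : Mat R n n} {x x′ y y′ : Vec R n} → G ≈ₘ G′ →
               (∀ i → x i ≈ x′ i) → (∀ i → y i ≈ y′ i) → Bform R G x y ≈ Bform R G′ x′ y′
  Bform-cong G≈G′ x≈x′ y≈y′ = Σ-cong (λ i → Σ-cong (λ j → *-cong (x≈x′ i) (*-cong (G≈G′ i j) (y≈y′ j))))

  Bform-zeroˡ : ∀ {n} (G : Mat R n n) y → Bform R G 0⃗ y ≈ 0#
  Bform-zeroˡ {n} G y = Σ-zero {n} (λ i → Σ-zero {n} (λ j → zeroˡ _))

  Bform-zeroʳ : ∀ {n} (G : Mat R n n) x → Bform R G x 0⃗ ≈ 0#
  Bform-zeroʳ {n} G x = Σ-zero {n} (λ i → Σ-zero {n} (λ j → trans (*-congˡ (zeroʳ _)) (zeroʳ _)))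

  Bform-transpose : ∀ {n} (G : Mat R n n) x y → Bform R G x y ≈ Bform R (flip G) y x
  Bform-transpose {n} G x y = trans (Σ-comm {n} {n} _) (Σ-cong (λ j → Σ-cong (λ i →
    solve 3 (λ a g b → a :* (g :* b) := b :* (g :* a)) refl (x i) (G i j) (y j))))

  Bform-sym : ∀ {n} {G : Mat R n n} → (∀ i j → G i j ≈ G j i) → ∀ x y → Bform R G x y ≈ Bform R G y x
  Bform-sym {G = G} G-sym x y =
    trans (Bform-transpose G x y) (Bform-cong (λ i j → G-sym j i) (λ _ → refl) (λ _ → refl))

  Bform-linearˡ : ∀ {m n} (G : Mat R m m) (X : Mat R m n) x y →
                  Bform R G (X *ᵥ x) y ≈ Σ n (λ p → x p * Bform R G (column R X p) y)
  Bform-linearˡ {m} {n} G X x y = begin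
    Σ m (λ i → Σ m (λ j → Σ n (λ p → X i p * x p) * (G i j * y j)))  ≈⟨ Σ-cong {m} (λ i → Σ-cong {m} (expand i)) ⟩
    Σ m (λ i → Σ m (λ j → Σ n (λ p → x p * T p i j)))                ≈⟨ Σ-cong {m} (λ i → Σ-comm {m} {n} _) ⟩
    Σ m (λ i → Σ n (λ p → Σ m (λ j → x p * T p i j)))                ≈⟨ Σ-comm {m} {n} _ ⟩
    Σ n (λ p → Σ m (λ i → Σ m (λ j → x p * T p i j)))                ≈⟨ Σ-cong {n} factor ⟨
    Σ n (λ p → x p * Σ m (λ i → Σ m (λ j → T p i j)))                ∎
    where
    T : Fin n → Fin m → Fin m → Carrier
    T p i j = X i p * (G i j * y j)
    expand : ∀ i j → Σ n (λ p → X i p * x p) * (G i j * y j) ≈ Σ n (λ p → x p * T p i j)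
    expand i j = trans (*-distribʳ-Σ {n} (G i j * y j) _) (Σ-cong {n} (λ p →
      solve 3 (λ a b c → (a :* b) :* c := b :* (a :* c)) refl (X i p) (x p) (G i j * y j)))
    factor : ∀ p → x p * Σ m (λ i → Σ m (λ j → T p i j)) ≈ Σ m (λ i → Σ m (λ j → x p * T p i j))
    factor p = trans (*-distribˡ-Σ {m} (x p) _) (Σ-cong {m} (λ i → *-distribˡ-Σ {m} (x p) _))

  Bform-linearʳ : ∀ {m n} (G : Mat R m m) (X : Mat R m n) x y →
                  Bform R G x (X *ᵥ y) ≈ Σ n (λ q → Bform R G x (column R X q) * y q)
  Bform-linearʳ {m} {n} G X x y = begin
    Bform R G x (X *ᵥ y)                                 ≈⟨ Bform-transpose G x (X *ᵥ y) ⟩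
    Bform R (flip G) (X *ᵥ y) x                          ≈⟨ Bform-linearˡ (flip G) X y x ⟩
    Σ n (λ q → y q * Bform R (flip G) (column R X q) x)  ≈⟨ Σ-cong {n} (λ q → *-comm _ _) ⟩
    Σ n (λ q → Bform R (flip G) (column R X q) x * y q)  ≈⟨ Σ-cong {n} (λ q → *-congʳ (Bform-transpose (flip G) _ x)) ⟩
    Σ n (λ q → Bform R G x (column R X q) * y q)         ∎

  Gram : ∀ {m n} → Mat R m m → Mat R m n → Mat R n n
  Gram M X i j = Bform R M (column R X i) (column R X j)

  Gram-cong : ∀ {m n} {M M′ : Mat R m m} {X X′ : Mat R m n} → M ≈ₘ M′ → X ≈ₘ X′ → Gram M X ≈ₘ Gram M′ X′
  Gram-cong M≈M′ X≈X′ i j = Bform-cong M≈M′ (λ k → X≈X′ k i) (λ k → X≈X′ k j)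

  Gram-· : ∀ {m n k} (G : Mat R m m) (X : Mat R m n) (Y : Mat R n k) → Gram G (X · Y) ≈ₘ Gram (Gram G X) Y
  Gram-· {n = n} G X Y i j = begin
    Bform R G (X *ᵥ column R Y i) (X *ᵥ column R Y j)                 ≈⟨ Bform-linearˡ G X _ _ ⟩
    Σ n (λ p → Y p i * Bform R G (column R X p) (X *ᵥ column R Y j))  ≈⟨ Σ-cong {n} (λ p → *-congˡ (Bform-linearʳ G X _ _)) ⟩
    Σ n (λ p → Y p i * Σ n (λ q → Gram G X p q * Y q j))              ≈⟨ Σ-cong {n} (λ p → *-distribˡ-Σ {n} (Y p i) _) ⟩
    Gram (Gram G X) Y i j                                             ∎

  Gram-Id : ∀ {n} (G : Mat R n n) → Gram G Id ≈ₘ G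
  Gram-Id {n} G i j = begin
    Bform R G (column R Id i) (column R Id j)  ≈⟨ Bform-cong {n} (λ _ _ → refl) (unitColumn i) (unitColumn j) ⟩
    Bform R G (δ R i) (δ R j)                  ≈⟨ Σ-cong {n} (λ r → *-distribˡ-Σ {n} _ _) ⟨
    δ R i ∙ (G *ᵥ δ R j)                       ≈⟨ δ-∙ i _ ⟩
    G i ∙ δ R j                                ≈⟨ ∙-δ (G i) j ⟩
    G i j                                      ∎
    where
    unitColumn : ∀ i k → column R Id i k ≈ δ R i k
    unitColumn i k = reflexive (δ-sym k i)

  infix 4 _⊒_
  _⊒_ : ∀ {m n} → Mat R m m → Mat R n n → Set (c ⊔ ℓ)
  _⊒_ {m} {n} M G = ∃ λ (X : Mat R m n) → Represents R M G X × ImageDirectSummand R X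

  ⊒-trans : ∀ {m k n} {M : Mat R m m} {K : Mat R k k} {G : Mat R n n} → M ⊒ K → K ⊒ G → M ⊒ G
  ⊒-trans {M = M} {K} {G} (A , A-rep , Y , YA≈I) (Z , Z-rep , P , PZ≈I) =
    A · Z , rep , P · Y , ·-inverse-conj {X = P} {Z} {Y} {A} PZ≈I YA≈I
    where
    rep : Gram M (A · Z) ≈ₘ G
    rep i j = begin
      Gram M (A · Z) i j     ≈⟨ Gram-· M A Z i j ⟩
      Gram (Gram M A) Z i j  ≈⟨ Gram-cong A-rep (λ _ _ → refl) i j ⟩
      Gram K Z i j           ≈⟨ Z-rep i j ⟩
      G i j                  ∎

  Gram-⊒ : ∀ {n} (G : Mat R n n) {P Z : Mat R n n} → P · Z ≈ₘ Id → Gram G P ⊒ G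
  Gram-⊒ G {P} {Z} PZ≈I = Z , rep , P , PZ≈I
    where
    rep : Gram (Gram G P) Z ≈ₘ G
    rep i j = begin
      Gram (Gram G P) Z i j  ≈⟨ Gram-· G P Z i j ⟨
      Gram G (P · Z) i j     ≈⟨ Gram-cong (λ _ _ → refl) PZ≈I i j ⟩
      Gram G Id i j          ≈⟨ Gram-Id G i j ⟩
      G i j                  ∎

  -- Units of R and extension of a primitive vector to a basis

  Unit-resp : ∀ {a b} → a ≈ b → Unit a → Unit b
  Unit-resp a≈b (a⁻¹ , aa⁻¹≈1) = a⁻¹ , trans (*-congʳ (sym a≈b)) aa⁻¹≈1

  Unit-*ʳ : ∀ a b → Unit (a * b) → Unit b
  Unit-*ʳ a b (x , abx≈1) = a * x , trans (solve 3 (λ a b x → b :* (a :* x) := (a :* b) :* x) refl a b x) abx≈1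

  Unit⊎two∣ : ∀ x → Unit x ⊎ two ∣R x
  Unit⊎two∣ x with two-uniformizer x
  ... | inj₁ x≈0                    = inj₂ (0# , trans x≈0 (sym (zeroʳ two)))
  ... | inj₂ (zero  , u , U , x≈u)  = inj₁ (Unit-resp (sym (trans x≈u (*-identityˡ u))) U)
  ... | inj₂ (suc k , u , _ , x≈2u) = inj₂ (two ^R k * u , trans x≈2u (*-assoc _ _ _))

  Unit-+ : ∀ x y → Unit (x + y) → Unit x ⊎ Unit y
  Unit-+ x y U with Unit⊎two∣ x | Unit⊎two∣ y
  ... | inj₁ Ux           | _                 = inj₁ Ux
  ... | inj₂ _            | inj₁ Uy           = inj₂ Uy
  ... | inj₂ (x′ , x≈2x′) | inj₂ (y′ , y≈2y′) = ⊥-elim (two-nonunit (Unit-*ʳ (x′ + y′) two (Unit-resp x+y≈x′+y′·2 U)))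
    where
    x+y≈x′+y′·2 : x + y ≈ (x′ + y′) * two
    x+y≈x′+y′·2 = trans (+-cong x≈2x′ y≈2y′) (trans (sym (distribˡ two x′ y′)) (*-comm two _))

  Unit-Σ : ∀ n (f : Vec R n) → Unit (Σ n f) → ∃ λ k → Unit (f k)
  Unit-Σ zero    f (x , 0x≈1) = ⊥-elim (nontrivial (trans (sym 0x≈1) (zeroˡ x)))
  Unit-Σ (suc n) f U with Unit-+ (f fzero) _ U
  ... | inj₁ Uf₀ = fzero , Uf₀
  ... | inj₂ UΣ with Unit-Σ n (f ∘ fsuc) UΣ
  ...   | k , Ufk = fsuc k , Ufk

  PrimitiveVec⇒Unit : ∀ {n} (v : Vec R n) → PrimitiveVec R v → ∃ λ k → Unit (v k)
  PrimitiveVec⇒Unit {n} v (Y , Yv≈δ) with Unit-Σ n (λ k → Y fzero k * v k) (Unit-resp (sym (Yv≈δ fzero fzero)) (1# , *-identityˡ 1#))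
  ... | k , U = k , Unit-*ʳ (Y fzero k) (v k) U

  permutationMatrix : ∀ {n} → Permutation′ n → Mat R n n
  permutationMatrix π r = δ R (π ⟨$⟩ˡ r)

  permutationMatrix-inverse : ∀ {n} (π : Permutation′ n) →
                              permutationMatrix π · permutationMatrix (Permutation.flip π) ≈ₘ Id
  permutationMatrix-inverse π r c = trans (δ-∙ (π ⟨$⟩ˡ r) _) (reflexive (≡.cong (flip (δ R) c) (inverseʳ π)))

  idWithColumn₀ : ∀ {n} → Vec R (suc n) → Mat R (suc n) (suc n)
  idWithColumn₀ y r fzero    = y r
  idWithColumn₀ y r (fsuc c) = δ R r (fsuc c)

  idWithColumn₀-inverse : ∀ {n} {y : Vec R (suc n)} {u} → y fzero * u ≈ 1# →
                          idWithColumn₀ y · idWithColumn₀ (u ∷ (λ i → - (y (fsuc i) * u))) ≈ₘ Id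
  idWithColumn₀-inverse {n} y₀u≈1 fzero    fzero    = trans (+-cong y₀u≈1 (∙-zeroˡ {n} _)) (+-identityʳ _)
  idWithColumn₀-inverse     y₀u≈1 (fsuc r) fzero    = trans (+-congˡ (δ-∙ r _)) (-‿inverseʳ _)
  idWithColumn₀-inverse {n} y₀u≈1 fzero    (fsuc c) = trans (+-cong (zeroʳ _) (∙-zeroˡ {n} _)) (+-identityʳ _)
  idWithColumn₀-inverse     y₀u≈1 (fsuc r) (fsuc c) = trans (+-cong (zeroʳ _) (δ-∙ r (flip (δ R) c))) (+-identityˡ _)

  extendToBasis : ∀ {n} (v : Vec R (suc n)) k → Unit (v k) →
                  ∃₂ λ P Z → P · Z ≈ₘ Id × (∀ r → P r fzero ≈ v r)
  extendToBasis {n} v k (u , vₖu≈1) =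
    S · E , E⁻¹ · S⁻¹ ,
    ·-inverse-conj {X = S} {S⁻¹} {E} {E⁻¹} (permutationMatrix-inverse π) (idWithColumn₀-inverse {y = y} vₖu≈1) ,
    λ r → trans (δ-∙ (π ⟨$⟩ˡ r) y) (reflexive (≡.cong v (inverseʳ π)))
    where
    π : Permutation′ (suc n)
    π = Permutation.transpose fzero k
    y : Vec R (suc n)
    y = v ∘ (π ⟨$⟩ʳ_)
    S S⁻¹ E E⁻¹ : Mat R (suc n) (suc n)
    S   = permutationMatrix π
    S⁻¹ = permutationMatrix (Permutation.flip π)
    E   = idWithColumn₀ y
    E⁻¹ = idWithColumn₀ (u ∷ (λ i → - (y (fsuc i) * u)))

  -- Orthogonal sums and hyperbolic spaces

  module _ {a b : ℕ} (G : Mat R a a) (H : Mat R b b) where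

    ⊥G-↑ˡ-↑ˡ : ∀ i j → _⊥G_ R G H (i ↑ˡ b) (j ↑ˡ b) ≡ G i j
    ⊥G-↑ˡ-↑ˡ i j rewrite splitAt-↑ˡ a i b | splitAt-↑ˡ a j b = ≡.refl

    ⊥G-↑ˡ-↑ʳ : ∀ i j → _⊥G_ R G H (i ↑ˡ b) (a ↑ʳ j) ≡ 0#
    ⊥G-↑ˡ-↑ʳ i j rewrite splitAt-↑ˡ a i b | splitAt-↑ʳ a b j = ≡.refl

    ⊥G-↑ʳ-↑ˡ : ∀ i j → _⊥G_ R G H (a ↑ʳ i) (j ↑ˡ b) ≡ 0#
    ⊥G-↑ʳ-↑ˡ i j rewrite splitAt-↑ʳ a b i | splitAt-↑ˡ a j b = ≡.refl

    ⊥G-↑ʳ-↑ʳ : ∀ i j → _⊥G_ R G H (a ↑ʳ i) (a ↑ʳ j) ≡ H i j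
    ⊥G-↑ʳ-↑ʳ i j rewrite splitAt-↑ʳ a b i | splitAt-↑ʳ a b j = ≡.refl

    Bform-⊥G : ∀ (x x′ : Vec R a) (y y′ : Vec R b) →
               Bform R (_⊥G_ R G H) (x ++ y) (x′ ++ y′) ≈ Bform R G x x′ + Bform R H y y′
    Bform-⊥G x x′ y y′ = trans (Σ-splitAt a _) (+-cong (Σ-cong {a} rowˡ) (Σ-cong {b} rowʳ))
      where
      F : Fin (a ℕ.+ b) → Fin (a ℕ.+ b) → Carrier
      F I K = (x ++ y) I * (_⊥G_ R G H I K * (x′ ++ y′) K)
      entry : ∀ {u g v u′ g′ v′} → u ≡ u′ → g ≡ g′ → v ≡ v′ → u * (g * v) ≈ u′ * (g′ * v′)
      entry ≡.refl ≡.refl ≡.refl = refl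
      cross : ∀ {u g v} → g ≡ 0# → u * (g * v) ≈ 0#
      cross ≡.refl = trans (*-congˡ (zeroˡ _)) (zeroʳ _)
      rowˡ : ∀ i → Σ (a ℕ.+ b) (F (i ↑ˡ b)) ≈ Σ a (λ j → x i * (G i j * x′ j))
      rowˡ i = trans (Σ-splitAt a _) (trans (+-cong
        (Σ-cong {a} (λ j → entry (lookup-++ˡ x y i) (⊥G-↑ˡ-↑ˡ i j) (lookup-++ˡ x′ y′ j)))
        (Σ-zero {b} (λ j → cross (⊥G-↑ˡ-↑ʳ i j)))) (+-identityʳ _))
      rowʳ : ∀ i → Σ (a ℕ.+ b) (F (a ↑ʳ i)) ≈ Σ b (λ j → y i * (H i j * y′ j))
      rowʳ i = trans (Σ-splitAt a _) (trans (+-cong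
        (Σ-zero {a} (λ j → cross (⊥G-↑ʳ-↑ˡ i j)))
        (Σ-cong {b} (λ j → entry (lookup-++ʳ x y i) (⊥G-↑ʳ-↑ʳ i j) (lookup-++ʳ x′ y′ j)))) (+-identityˡ _))

  Bform-hyperbolic : ∀ p q p′ q′ → Bform R (hyperbolic R) (p ∷ q ∷ []) (p′ ∷ q′ ∷ []) ≈ p * q′ + q * p′
  Bform-hyperbolic = solve 4 (λ p q p′ q′ →
    (p :* (con 0 :* p′) :+ (p :* (con 1 :* q′) :+ con 0)) :+ ((q :* (con 1 :* p′) :+ (q :* (con 0 :* q′) :+ con 0)) :+ con 0)
    := p :* q′ :+ q :* p′) refl

  hyperbolicVec : ∀ k → Vec R k → Vec R k → Vec R (hdim R k)
  hyperbolicVec zero    f g = []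
  hyperbolicVec (suc k) f g = (f fzero ∷ g fzero ∷ []) ++ hyperbolicVec k (f ∘ fsuc) (g ∘ fsuc)

  module FirstPair {k} (f g f′ g′ : Vec R (suc k)) where
    f₀ g₀ f₀′ g₀′ : Carrier
    f₀ = f fzero ; g₀ = g fzero ; f₀′ = f′ fzero ; g₀′ = g′ fzero
    f₊ g₊ f₊′ g₊′ : Vec R k
    f₊ = f ∘ fsuc ; g₊ = g ∘ fsuc ; f₊′ = f′ ∘ fsuc ; g₊′ = g′ ∘ fsuc
    p p′ : Vec R 2
    p = f₀ ∷ g₀ ∷ [] ; p′ = f₀′ ∷ g₀′ ∷ []
    t t′ : Vec R (hdim R k)
    t = hyperbolicVec k f₊ g₊ ; t′ = hyperbolicVec k f₊′ g₊′

  Bform-Hpow : ∀ k (f g f′ g′ : Vec R k) →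
               Bform R (Hpow R k) (hyperbolicVec k f g) (hyperbolicVec k f′ g′) ≈ f ∙ g′ + g ∙ f′
  Bform-Hpow zero    f g f′ g′ = sym (+-identityˡ 0#)
  Bform-Hpow (suc k) f g f′ g′ = begin
    Bform R (_⊥G_ R (hyperbolic R) (Hpow R k)) (p ++ t) (p′ ++ t′)  ≈⟨ Bform-⊥G (hyperbolic R) (Hpow R k) p p′ t t′ ⟩
    Bform R (hyperbolic R) p p′ + Bform R (Hpow R k) t t′           ≈⟨ +-cong (Bform-hyperbolic f₀ g₀ f₀′ g₀′) (Bform-Hpow k f₊ g₊ f₊′ g₊′) ⟩
    (f₀ * g₀′ + g₀ * f₀′) + (f₊ ∙ g₊′ + g₊ ∙ f₊′)                     ≈⟨ +-interchange _ _ _ _ ⟩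
    f ∙ g′ + g ∙ f′                                                 ∎
    where open FirstPair f g f′ g′

  ∙-hyperbolicVec : ∀ k (f g f′ g′ : Vec R k) →
                    hyperbolicVec k f g ∙ hyperbolicVec k f′ g′ ≈ f ∙ f′ + g ∙ g′
  ∙-hyperbolicVec zero    f g f′ g′ = sym (+-identityˡ 0#)
  ∙-hyperbolicVec (suc k) f g f′ g′ = begin
    (p ++ t) ∙ (p′ ++ t′)                           ≈⟨ ∙-++ p p′ t t′ ⟩
    (f₀ * f₀′ + (g₀ * g₀′ + 0#)) + t ∙ t′           ≈⟨ +-cong (+-congˡ (+-identityʳ _)) (∙-hyperbolicVec k f₊ g₊ f₊′ g₊′) ⟩
    (f₀ * f₀′ + g₀ * g₀′) + (f₊ ∙ f₊′ + g₊ ∙ g₊′)  ≈⟨ +-interchange _ _ _ _ ⟩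
    f ∙ f′ + g ∙ g′                                 ∎
    where open FirstPair f g f′ g′

  -- The hyperbolic representation

  upperHalf : ∀ {n} → Mat R n n → Vec R n → Mat R n n
  upperHalf K h fzero    fzero    = h fzero
  upperHalf K h fzero    (fsuc j) = K fzero (fsuc j)
  upperHalf K h (fsuc i) fzero    = 0#
  upperHalf K h (fsuc i) (fsuc j) = upperHalf (λ i j → K (fsuc i) (fsuc j)) (h ∘ fsuc) i j

  upperHalf-+-transpose : ∀ {n} {K : Mat R n n} {h : Vec R n} →
    (∀ i j → K i j ≈ K j i) → (∀ i → K i i ≈ two * h i) →
    ∀ i j → upperHalf K h i j + upperHalf K h j i ≈ K i j
  upperHalf-+-transpose {K = K} {h} K-sym K≈2h fzero fzero = sym (begin
    K fzero fzero                ≈⟨ K≈2h fzero ⟩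
    two * h fzero                ≈⟨ distribʳ (h fzero) 1# 1# ⟩
    1# * h fzero + 1# * h fzero  ≈⟨ +-cong (*-identityˡ _) (*-identityˡ _) ⟩
    h fzero + h fzero            ∎)
  upperHalf-+-transpose K-sym K≈2h fzero    (fsuc j) = +-identityʳ _
  upperHalf-+-transpose K-sym K≈2h (fsuc i) fzero    = trans (+-identityˡ _) (K-sym fzero (fsuc i))
  upperHalf-+-transpose K-sym K≈2h (fsuc i) (fsuc j) =
    upperHalf-+-transpose (λ i j → K-sym (fsuc i) (fsuc j)) (K≈2h ∘ fsuc) i j

  module HyperbolicEmbedding {n m} (K : Mat R (suc n) (suc n)) (H : Mat R m m) (h : Vec R n) (w ψ : Vec R m) where

    C : Mat R n n
    C = upperHalf (λ i j → K (fsuc i) (fsuc j)) h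

    b : Vec R n
    b j = K fzero (fsuc j)

    embedding : Mat R (hdim R n ℕ.+ m) (suc n)
    embedding r fzero    = (hyperbolicVec n 0⃗ b ++ w) r
    embedding r (fsuc i) = (hyperbolicVec n (δ R i) (C i) ++ 0⃗) r

    retraction : Mat R (suc n) (hdim R n ℕ.+ m)
    retraction fzero    = hyperbolicVec n 0⃗ 0⃗ ++ ψ
    retraction (fsuc i) = hyperbolicVec n (δ R i) 0⃗ ++ 0⃗

    Bform-split : ∀ (f g f′ g′ : Vec R n) (t t′ : Vec R m) →
      Bform R (_⊥G_ R (Hpow R n) H) (hyperbolicVec n f g ++ t) (hyperbolicVec n f′ g′ ++ t′) ≈
      (f ∙ g′ + g ∙ f′) + Bform R H t t′
    Bform-split f g f′ g′ t t′ = trans (Bform-⊥G (Hpow R n) H _ _ t t′) (+-congʳ (Bform-Hpow n f g f′ g′))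

    ∙-split : ∀ (f g f′ g′ : Vec R n) (t t′ : Vec R m) →
      (hyperbolicVec n f g ++ t) ∙ (hyperbolicVec n f′ g′ ++ t′) ≈ (f ∙ f′ + g ∙ g′) + t ∙ t′
    ∙-split f g f′ g′ t t′ =
      trans (∙-++ (hyperbolicVec n f g) (hyperbolicVec n f′ g′) t t′) (+-congʳ (∙-hyperbolicVec n f g f′ g′))

    embedding-represents : (∀ i j → K i j ≈ K j i) → (∀ i → K (fsuc i) (fsuc i) ≈ two * h i) →
                           Qform R H w ≈ K fzero fzero → Represents R (_⊥G_ R (Hpow R n) H) K embedding
    embedding-represents K-sym K≈2h Qw≈K₀₀ fzero fzero = trans (Bform-split 0⃗ b 0⃗ b w w)
      (trans (+-cong (+-cong (∙-zeroˡ b) (∙-zeroʳ b)) Qw≈K₀₀)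
             (trans (+-congʳ (+-identityˡ 0#)) (+-identityˡ _)))
    embedding-represents K-sym K≈2h Qw≈K₀₀ fzero (fsuc j) = trans (Bform-split 0⃗ b (δ R j) (C j) w 0⃗)
      (trans (+-cong (+-cong (∙-zeroˡ (C j)) (∙-δ b j)) (Bform-zeroʳ H w))
             (trans (+-identityʳ _) (+-identityˡ _)))
    embedding-represents K-sym K≈2h Qw≈K₀₀ (fsuc i) fzero = trans (Bform-split (δ R i) (C i) 0⃗ b 0⃗ w)
      (trans (+-cong (+-cong (δ-∙ i b) (∙-zeroʳ (C i))) (Bform-zeroˡ H w))
             (trans (+-identityʳ _) (trans (+-identityʳ _) (K-sym fzero (fsuc i)))))
    embedding-represents K-sym K≈2h Qw≈K₀₀ (fsuc i) (fsuc j) = trans (Bform-split (δ R i) (C i) (δ R j) (C j) 0⃗ 0⃗)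
      (trans (+-cong (+-cong (δ-∙ i (C j)) (∙-δ (C i) j)) (Bform-zeroˡ H 0⃗))
             (trans (+-identityʳ _) (trans (+-comm _ _) (upperHalf-+-transpose (λ i j → K-sym (fsuc i) (fsuc j)) K≈2h i j))))

    retraction-leftInverse : ψ ∙ w ≈ 1# → retraction · embedding ≈ₘ Id
    retraction-leftInverse ψw≈1 fzero fzero = trans (∙-split 0⃗ 0⃗ 0⃗ b ψ w)
      (trans (+-cong (+-cong (∙-zeroˡ {n} 0⃗) (∙-zeroˡ b)) ψw≈1)
             (trans (+-congʳ (+-identityˡ 0#)) (+-identityˡ _)))
    retraction-leftInverse ψw≈1 fzero (fsuc j) = trans (∙-split 0⃗ 0⃗ (δ R j) (C j) ψ 0⃗)
      (trans (+-cong (+-cong (∙-zeroˡ (δ R j)) (∙-zeroˡ (C j))) (∙-zeroʳ ψ))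
             (trans (+-identityʳ _) (+-identityˡ 0#)))
    retraction-leftInverse ψw≈1 (fsuc i) fzero = trans (∙-split (δ R i) 0⃗ 0⃗ b 0⃗ w)
      (trans (+-cong (+-cong (∙-zeroʳ (δ R i)) (∙-zeroˡ b)) (∙-zeroˡ w))
             (trans (+-identityʳ _) (+-identityˡ 0#)))
    retraction-leftInverse ψw≈1 (fsuc i) (fsuc j) = trans (∙-split (δ R i) 0⃗ (δ R j) (C j) 0⃗ 0⃗)
      (trans (+-cong (+-cong (δ-∙ i (δ R j)) (∙-zeroˡ (C j))) (∙-zeroˡ {m} 0⃗))
             (trans (+-identityʳ _) (trans (+-identityʳ _) (reflexive (δ-sym j i)))))

  Hpow⊥-⊒-matchingCorner : ∀ {n m} (K : Mat R (suc n) (suc n)) (H : Mat R m m) →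
    (∀ i j → K i j ≈ K j i) → (∀ i → two ∣R K (fsuc i) (fsuc i)) →
    ∀ w → PrimitiveVec R w → Qform R H w ≈ K fzero fzero → _⊥G_ R (Hpow R n) H ⊒ K
  Hpow⊥-⊒-matchingCorner K H K-sym K-even w (Y , Yw≈δ) Qw≈K₀₀ =
    embedding , embedding-represents K-sym (proj₂ ∘ K-even) Qw≈K₀₀ ,
    retraction , retraction-leftInverse (Yw≈δ fzero fzero)
    where open HyperbolicEmbedding K H (proj₁ ∘ K-even) w (Y fzero)

  Hpow⊥-⊒ : ∀ {n m} (G : Mat R (suc n) (suc n)) (H : Mat R m m) →
    (∀ i j → G i j ≈ G j i) → (∀ x → two ∣R Qform R G x) →
    ∀ v w → PrimitiveVec R v → PrimitiveVec R w → Qform R G v ≈ Qform R H w →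
    _⊥G_ R (Hpow R n) H ⊒ G
  Hpow⊥-⊒ G H G-sym G-even v w v-prim w-prim Qv≈Qw =
    let k , Uvₖ             = PrimitiveVec⇒Unit v v-prim
        P , Z , PZ≈I , P₀≈v = extendToBasis v k Uvₖ
        K-sym p q           = Bform-sym {G = G} G-sym (column R P p) (column R P q)
        Qw≈K₀₀              = sym (trans (Bform-cong {G = G} (λ _ _ → refl) P₀≈v P₀≈v) Qv≈Qw)
    in ⊒-trans (Hpow⊥-⊒-matchingCorner (Gram G P) H K-sym (G-even ∘ column R P ∘ fsuc) w w-prim Qw≈K₀₀)
               (Gram-⊒ G {P} {Z} PZ≈I)

lemma6p6 : ∀ {c ℓ : Level} (R : UnramifiedDyadicLocalRing c ℓ)
             (L J : Lattice R) →
             1 ≤ Lattice.rank L →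
             Even R L →
             (∃ λ a → _∈Q*_ R a L × _∈Q*_ R a J) →
             PrimitivelyRepresents R
               (_⊥G_ R (Hpow R (Lattice.rank L ∸ 1)) (Lattice.gram J)) L
lemma6p6 R record { rank = zero } J () _ _
lemma6p6 R record { rank = suc _ ; gram = G ; symmetric = G-sym } J _ even
         (_ , (v , v-prim , Qv≈a) , (w , w-prim , Qw≈a)) =
  Hpow⊥-⊒ R G (Lattice.gram J) G-sym even v w v-prim w-prim (trans Qv≈a (sym Qw≈a))
  where open UnramifiedDyadicLocalRing R using (trans; sym)
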